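{- Let $p$ be an odd prime and $r\ge1$. The number of conjugacy classes of $K(p^r)$ is $(p-1)p^{r-1}+\dfrac{p^r-1}{p-1}$.
   Context: $K(p^r)$ is the group of elements $z^j\sigma$ with $j\in\mathbb{Z}/p^r\mathbb{Z}$, $\sigma\in(\mathbb{Z}/p^r\mathbb{Z})^*$ and multiplication $z^i\sigma\,z^j\tau=z^{i+\sigma j}\sigma\tau$ (the holomorph of the cyclic group of order $p^r$). -}

module Defs where

open import Data.Nat using (ℕ; _+_; _*_; _∸_; _^_; _<_; NonZero)
open import Data.Nat.DivMod using (_%_; _/_)
open import Data.Nat.Coprimality using (Coprime)
open import Data.Product using (Σ; ∃; _×_; _,_; proj₁)
open import Data.List using (List; length)
open import Data.List.Relation.Unary.All using (All)
open import Data.List.Relation.Unary.Any using (Any)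
open import Data.List.Relation.Unary.AllPairs using (AllPairs)
open import Relation.Binary.PropositionalEquality using (_≡_)
open import Relation.Nullary using (¬_)

-- The holomorph K(n) of the cyclic group Z/nZ, n = p^r.
-- An element z^j σ is represented by the pair (j , σ) of residues
-- 0 ≤ j < n, 0 ≤ σ < n with gcd σ n = 1.
IsK : (n : ℕ) → ℕ × ℕ → Set
IsK n (j , σ) = j < n × σ < n × Coprime σ n

K : ℕ → Set
K n = Σ (ℕ × ℕ) (IsK n)

-- z^i σ · z^j τ = z^{i + σ j} σ τ   (reduced mod n)
mulK : (n : ℕ) .{{_ : NonZero n}} → ℕ × ℕ → ℕ × ℕ → ℕ × ℕ
mulK n (i , σ) (j , τ) = ((i + σ * j) % n , (σ * τ) % n)

-- g and h are conjugate in K(n): h = x g x⁻¹ for some x ∈ K(n),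
-- written without inverses as  x g = h x.
Conj : (n : ℕ) .{{_ : NonZero n}} → K n → K n → Set
Conj n g h = ∃ λ (x : K n) →
  mulK n (proj₁ x) (proj₁ g) ≡ mulK n (proj₁ h) (proj₁ x)

NumConjClasses : (n : ℕ) .{{_ : NonZero n}} → ℕ → Set
NumConjClasses n c = Σ (List (K n)) λ reps →
  length reps ≡ c ×
  AllPairs (λ a b → ¬ Conj n a b) reps ×
  ((g : K n) → Any (λ a → Conj n g a) reps)

classFormula : (p r : ℕ) .{{_ : NonZero (p ∸ 1)}} → ℕ
classFormula p r = (p ∸ 1) * p ^ (r ∸ 1) + (p ^ r ∸ 1) / (p ∸ 1)

-- Conjugating z^j σ by z^a τ gives z^(τ j + (1 - σ) a) σ. So σ is a class invariant, and for every
-- q ∣ p^r with σ ≡ 1 (mod q) so is whether q divides j. Rescaling j by units and shifting it by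
-- multiples of σ - 1 moves every element to z^0 σ (σ any unit) or to z^(p^e) σ with e < r and
-- σ ≡ 1 (mod p^(e+1)), and these invariants separate all of them. There are (p - 1) p^(r-1)
-- representatives of the first kind and Σ_{e<r} p^(r-1-e) = (p^r - 1)/(p - 1) of the second.

module Submission where

open import Defs
open import Data.Nat using (ℕ; _≤_; _∸_; _^_; NonZero)
open import Data.Nat.Divisibility using (_∣_)
open import Data.Nat.Primality using (Prime)
open import Relation.Nullary using (¬_)

open import Level using (0ℓ)
open import Function.Bundles using (_⇔_; mk⇔; Equivalence)
open import Data.Empty using (⊥-elim)
open import Data.Sum using (inj₁; inj₂)
open import Data.Product using (∃; ∃₂; _,_; proj₁)
open import Data.Product.Properties using (,-injectiveˡ; ,-injectiveʳ)
open import Relation.Nullary using (contradiction; yes; no)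
open import Relation.Unary using (Pred)
open import Relation.Binary.Core using (Rel)
open import Relation.Binary.Bundles using (Setoid)
open import Relation.Binary.Structures using (IsEquivalence)
open import Relation.Binary.Definitions using (tri<; tri≈; tri>)
open import Relation.Binary.PropositionalEquality
open import Data.Nat.Base
  using (zero; suc; _+_; _*_; _<_; z<s; s<s; s<s⁻¹; NonTrivial; >-nonZero; n>1⇒nonTrivial; nonTrivial⇒n>1; nonTrivial⇒≢1)
open import Data.Nat.Properties
open import Data.Nat.DivMod
  using (_%_; _/_; m%n<n; m≡m%n+[m/n]*n; [m+kn]%n≡m%n; m<n⇒m%n≡m; m*n/n≡m; m<n*o⇒m/o<n)
open import Data.Nat.Divisibility
  using ( divides; _∣0; 1∣_; _∣?_; ∣-trans; ∣1⇒≡1; ∣m+n∣m⇒∣n; ∣m∣n⇒∣m+n; ∣m⇒∣m*n; ∣n⇒∣m*n; m∣m*n; n∣m*n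
        ; *-monoˡ-∣; >⇒∤; ∣n∣m%n⇒∣m; n∣m⇒m%n≡0; m%n≡0⇒n∣m)
open import Data.Nat.Coprimality using (Coprime; coprime-Bézout; coprime-divisor)
import Data.Nat.Coprimality as Coprime
import Data.Nat.GCD as GCD
open import Data.Nat.Primality using (prime⇒irreducible; prime⇒nonTrivial; ¬prime[0])
open import Data.Nat.ListAction using (sum)
open import Data.Nat.Tactic.RingSolver using (solve-∀)
open import Data.Fin as Fin using (Fin; toℕ; fromℕ<)
open import Data.Fin.Properties using (toℕ<n; toℕ-fromℕ<; toℕ-injective)
open import Data.List using (List; _++_; concat; tabulate; length)
open import Data.List.Properties using (length-++; length-tabulate)
open import Data.List.Relation.Unary.All using (All)
open import Data.List.Relation.Unary.Any using (Any)
import Data.List.Relation.Unary.Any as Any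
open import Data.List.Relation.Unary.AllPairs using (AllPairs)
import Data.List.Relation.Unary.All.Properties as AllP
import Data.List.Relation.Unary.Any.Properties as AnyP
import Data.List.Relation.Unary.AllPairs.Properties as AllPairsP

-- Congruence without subtraction: both sides may be shifted by multiples of q.
infix 4 _≡_mod_

_≡_mod_ : ℕ → ℕ → ℕ → Set
x ≡ y mod q = ∃₂ λ u v → x + u * q ≡ y + v * q

module _ {q : ℕ} where

  ≡-mod-reflexive : ∀ {x y} → x ≡ y → x ≡ y mod q
  ≡-mod-reflexive x≡y = 0 , 0 , cong (_+ 0) x≡y

  ≡-mod-sym : ∀ {x y} → x ≡ y mod q → y ≡ x mod q
  ≡-mod-sym (u , v , eq) = v , u , sym eq

  ≡-mod-trans : ∀ {x y z} → x ≡ y mod q → y ≡ z mod q → x ≡ z mod q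
  ≡-mod-trans {x} {y} {z} (u , v , eq) (u′ , v′ , eq′) = u + u′ , v′ + v , (begin
    x + (u + u′) * q     ≡⟨ shift x u u′ q ⟩
    (x + u * q) + u′ * q ≡⟨ cong (_+ u′ * q) eq ⟩
    (y + v * q) + u′ * q ≡⟨ swap y v u′ q ⟩
    (y + u′ * q) + v * q ≡⟨ cong (_+ v * q) eq′ ⟩
    (z + v′ * q) + v * q ≡⟨ sym (shift z v′ v q) ⟩
    z + (v′ + v) * q     ∎)
    where
    open ≡-Reasoning
    shift : ∀ x u u′ q → x + (u + u′) * q ≡ (x + u * q) + u′ * q
    shift = solve-∀
    swap : ∀ y v u′ q → (y + v * q) + u′ * q ≡ (y + u′ * q) + v * q
    swap = solve-∀

  ≡-mod-isEquivalence : IsEquivalence (λ x y → x ≡ y mod q)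
  ≡-mod-isEquivalence = record
    { refl = ≡-mod-reflexive refl ; sym = ≡-mod-sym ; trans = ≡-mod-trans }

  ≡-mod-setoid : Setoid 0ℓ 0ℓ
  ≡-mod-setoid = record { isEquivalence = ≡-mod-isEquivalence }

  +-cong-≡-mod : ∀ {x y x′ y′} → x ≡ y mod q → x′ ≡ y′ mod q → x + x′ ≡ y + y′ mod q
  +-cong-≡-mod {x} {y} {x′} {y′} (u , v , eq) (u′ , v′ , eq′) = u + u′ , v + v′ , (begin
    x + x′ + (u + u′) * q       ≡⟨ interchange x x′ u u′ q ⟩
    (x + u * q) + (x′ + u′ * q) ≡⟨ cong₂ _+_ eq eq′ ⟩
    (y + v * q) + (y′ + v′ * q) ≡⟨ sym (interchange y y′ v v′ q) ⟩
    y + y′ + (v + v′) * q       ∎)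
    where
    open ≡-Reasoning
    interchange : ∀ a b u u′ q → a + b + (u + u′) * q ≡ (a + u * q) + (b + u′ * q)
    interchange = solve-∀

  +-congˡ-≡-mod : ∀ a {x y} → x ≡ y mod q → a + x ≡ a + y mod q
  +-congˡ-≡-mod a = +-cong-≡-mod (≡-mod-reflexive refl)

  *-congˡ-≡-mod : ∀ c {x y} → x ≡ y mod q → c * x ≡ c * y mod q
  *-congˡ-≡-mod c {x} {y} (u , v , eq) = c * u , c * v , (begin
    c * x + c * u * q ≡⟨ distrib c x u q ⟩
    c * (x + u * q)   ≡⟨ cong (c *_) eq ⟩
    c * (y + v * q)   ≡⟨ sym (distrib c y v q) ⟩
    c * y + c * v * q ∎)
    where
    open ≡-Reasoning
    distrib : ∀ c x u q → c * x + c * u * q ≡ c * (x + u * q)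
    distrib = solve-∀

  *-congʳ-≡-mod : ∀ c {x y} → x ≡ y mod q → x * c ≡ y * c mod q
  *-congʳ-≡-mod c {x} {y} x≡y =
    subst₂ (λ x y → x ≡ y mod q) (*-comm c x) (*-comm c y) (*-congˡ-≡-mod c x≡y)

  +-cancelˡ-≡-mod : ∀ a {x y} → a + x ≡ a + y mod q → x ≡ y mod q
  +-cancelˡ-≡-mod a {x} {y} (u , v , eq) =
    u , v , +-cancelˡ-≡ a _ _ (trans (sym (+-assoc a x (u * q))) (trans eq (+-assoc a y (v * q))))

  +-*-≡-mod : ∀ x k → x + k * q ≡ x mod q
  +-*-≡-mod x k = 0 , k , +-identityʳ _

  ∣⇒≡0-mod : ∀ {x} → q ∣ x → x ≡ 0 mod q
  ∣⇒≡0-mod (divides w refl) = +-*-≡-mod 0 w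

  ∣-resp-≡-mod : ∀ {x y} → x ≡ y mod q → q ∣ y → q ∣ x
  ∣-resp-≡-mod {x} (u , v , eq) q∣y =
    ∣m+n∣m⇒∣n (subst (q ∣_) (trans (sym eq) (+-comm x (u * q))) (∣m∣n⇒∣m+n q∣y (n∣m*n v)))
              (n∣m*n u)

  ∣⇔∣-≡-mod : ∀ {τ x y} → Coprime q τ → τ * x ≡ y mod q → q ∣ x ⇔ q ∣ y
  ∣⇔∣-≡-mod {τ} q⊥τ τx≡y = mk⇔
    (λ q∣x → ∣-resp-≡-mod (≡-mod-sym τx≡y) (∣n⇒∣m*n τ q∣x))
    (λ q∣y → coprime-divisor q⊥τ (∣-resp-≡-mod τx≡y q∣y))

  module _ .{{_ : NonZero q}} where

    %-≡-mod : ∀ x → x % q ≡ x mod q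
    %-≡-mod x = x / q , 0 , trans (sym (m≡m%n+[m/n]*n x q)) (sym (+-identityʳ x))

    ≡-mod⇒%≡ : ∀ {x y} → x ≡ y mod q → x % q ≡ y % q
    ≡-mod⇒%≡ {x} {y} (u , v , eq) = begin
      x % q           ≡⟨ sym ([m+kn]%n≡m%n x u q) ⟩
      (x + u * q) % q ≡⟨ cong (_% q) eq ⟩
      (y + v * q) % q ≡⟨ [m+kn]%n≡m%n y v q ⟩
      y % q           ∎
      where open ≡-Reasoning

    %≡⇒≡-mod : ∀ {x y} → x % q ≡ y % q → x ≡ y mod q
    %≡⇒≡-mod {x} {y} x%q≡y%q =
      ≡-mod-trans (≡-mod-sym (%-≡-mod x)) (subst (_≡ y mod q) (sym x%q≡y%q) (%-≡-mod y))

    ≡-mod⇒≡ : ∀ {x y} → x < q → y < q → x ≡ y mod q → x ≡ y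
    ≡-mod⇒≡ x<q y<q x≡y =
      trans (sym (m<n⇒m%n≡m x<q)) (trans (≡-mod⇒%≡ x≡y) (m<n⇒m%n≡m y<q))

≡-mod-∣ : ∀ {d q x y} → d ∣ q → x ≡ y mod q → x ≡ y mod d
≡-mod-∣ {d} {x = x} {y} (divides k refl) (u , v , eq) = u * k , v * k ,
  trans (cong (x +_) (*-assoc u k d)) (trans eq (cong (y +_) (sym (*-assoc v k d))))

module ≡-mod-Reasoning (q : ℕ) where
  open import Relation.Binary.Reasoning.Setoid (≡-mod-setoid {q}) public

inverse-mod : ∀ {n u} .{{_ : NonZero n}} → Coprime u n → ∃ λ u′ → u′ * u ≡ 1 mod n
inverse-mod {suc n′} {u} u⊥n with coprime-Bézout u⊥n
... | GCD.Bézout.+- x y eq = x , 0 , y , trans (+-identityʳ _) (sym eq)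
-- Here 1 + x u ≡ 0 (mod n), so -x ≡ x (n - 1) is an inverse.
... | GCD.Bézout.-+ x y eq = x * n′ , y , x * u , (begin
  x * n′ * u + y * suc n′   ≡⟨ cong (x * n′ * u +_) (sym eq) ⟩
  x * n′ * u + (1 + x * u)  ≡⟨ collect x n′ u ⟩
  1 + x * u * suc n′        ∎)
  where
  open ≡-Reasoning
  collect : ∀ x n′ u → x * n′ * u + (1 + x * u) ≡ 1 + x * u * suc n′
  collect = solve-∀

module _ {n : ℕ} .{{_ : NonZero n}} where

  *-cancelˡ-≡-mod : ∀ {τ x y} → Coprime τ n → τ * x ≡ τ * y mod n → x ≡ y mod n
  *-cancelˡ-≡-mod {τ} {x} {y} τ⊥n τx≡τy with inverse-mod τ⊥n
  ... | τ′ , τ′τ≡1 = begin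
    x            ≡⟨ sym (*-identityˡ x) ⟩
    1 * x        ≈⟨ ≡-mod-sym (*-congʳ-≡-mod x τ′τ≡1) ⟩
    τ′ * τ * x   ≡⟨ *-assoc τ′ τ x ⟩
    τ′ * (τ * x) ≈⟨ *-congˡ-≡-mod τ′ τx≡τy ⟩
    τ′ * (τ * y) ≡⟨ sym (*-assoc τ′ τ y) ⟩
    τ′ * τ * y   ≈⟨ *-congʳ-≡-mod y τ′τ≡1 ⟩
    1 * y        ≡⟨ *-identityˡ y ⟩
    y            ∎
    where open ≡-mod-Reasoning n

  inverse-mod-coprime : ∀ {τ τ′} → τ′ * τ ≡ 1 mod n → Coprime τ′ n
  inverse-mod-coprime {τ} {τ′} (u , v , eq) {d} (d∣τ′ , d∣n) =
    ∣1⇒≡1 (∣m+n∣m⇒∣n d∣vn+1 (∣n⇒∣m*n v d∣n))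
    where
    d∣vn+1 : d ∣ v * n + 1
    d∣vn+1 = subst (d ∣_) (trans eq (+-comm 1 (v * n)))
      (∣m∣n⇒∣m+n (∣m⇒∣m*n τ d∣τ′) (∣n⇒∣m*n u d∣n))

  coprime-% : ∀ {τ} → Coprime τ n → Coprime (τ % n) n
  coprime-% τ⊥n (d∣τ%n , d∣n) = τ⊥n (∣n∣m%n⇒∣m d∣n d∣τ%n , d∣n)

translation unit : ∀ {n} → K n → ℕ
translation ((j , _) , _) = j
unit ((_ , σ) , _) = σ

module _ {n : ℕ} .{{_ : NonZero n}} where

  conj-intro : ∀ {j k σ} (g : IsK n (j , σ)) (h : IsK n (k , σ)) a τ → Coprime τ n →
               a + τ * j ≡ k + σ * a mod n → Conj n ((j , σ) , g) ((k , σ) , h)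
  conj-intro {j} {k} {σ} _ _ a τ τ⊥n eq =
    ((a % n , τ % n) , m%n<n a n , m%n<n τ n , coprime-% τ⊥n) ,
    cong₂ _,_ (≡-mod⇒%≡ translations) (cong (_% n) (*-comm (τ % n) σ))
    where
    open ≡-mod-Reasoning n
    translations : a % n + τ % n * j ≡ k + σ * (a % n) mod n
    translations = begin
      a % n + τ % n * j ≈⟨ +-cong-≡-mod (%-≡-mod a) (*-congʳ-≡-mod j (%-≡-mod τ)) ⟩
      a + τ * j         ≈⟨ eq ⟩
      k + σ * a         ≈⟨ +-congˡ-≡-mod k (*-congˡ-≡-mod σ (≡-mod-sym (%-≡-mod a))) ⟩
      k + σ * (a % n)   ∎

  conj-to-divisor : ∀ {j d σ J} (g : IsK n (j , σ)) (h : IsK n (d , σ)) → Coprime J n → j ≡ J * d →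
                    Conj n (_ , g) (_ , h)
  conj-to-divisor {d = d} {σ} {J} g h J⊥n refl with inverse-mod J⊥n
  ... | J′ , J′J≡1 = conj-intro g h 0 J′ (inverse-mod-coprime J′J≡1) (begin
    J′ * (J * d) ≡⟨ sym (*-assoc J′ J d) ⟩
    J′ * J * d   ≈⟨ *-congʳ-≡-mod d J′J≡1 ⟩
    1 * d        ≡⟨ *-identityˡ d ⟩
    d            ≡⟨ sym (trans (cong (d +_) (*-zeroʳ σ)) (+-identityʳ d)) ⟩
    d + σ * 0    ∎)
    where open ≡-mod-Reasoning n

  conj-to-0 : ∀ {j s w d} (g : IsK n (j , suc s)) (h : IsK n (0 , suc s)) →
              Coprime w n → s ≡ w * d → d ∣ j → Conj n (_ , g) (_ , h)
  conj-to-0 {w = w} {d} g h w⊥n refl (divides J refl) with inverse-mod w⊥n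
  ... | w′ , w′w≡1 = conj-intro g h a 1 (Coprime.1-coprimeTo n) (begin
    a + 1 * (J * d)  ≡⟨ cong (a +_) (*-identityˡ (J * d)) ⟩
    a + J * d        ≈⟨ +-congˡ-≡-mod a (≡-mod-sym sa≡Jd) ⟩
    a + w * d * a    ∎)
    where
    open ≡-mod-Reasoning n
    a = J * w′
    regroup : ∀ w d J w′ → w * d * (J * w′) ≡ w′ * w * (J * d)
    regroup = solve-∀
    sa≡Jd : w * d * a ≡ J * d mod n
    sa≡Jd = begin
      w * d * a        ≡⟨ regroup w d J w′ ⟩
      w′ * w * (J * d) ≈⟨ *-congʳ-≡-mod (J * d) w′w≡1 ⟩
      1 * (J * d)      ≡⟨ *-identityˡ (J * d) ⟩
      J * d            ∎

  conj⇒unit≡ : (g h : K n) → Conj n g h → unit g ≡ unit h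
  conj⇒unit≡ ((_ , σ) , _ , σ<n , _) ((_ , σ′) , _ , σ′<n , _) (((_ , τ) , _ , _ , τ⊥n) , eq) =
    ≡-mod⇒≡ σ<n σ′<n (*-cancelˡ-≡-mod τ⊥n τσ≡τσ′)
    where
    τσ≡τσ′ : τ * σ ≡ τ * σ′ mod n
    τσ≡τσ′ = %≡⇒≡-mod (trans (,-injectiveʳ eq) (cong (_% n) (*-comm σ′ τ)))

  translation-≡-mod : ∀ {a τ j k s q} → a + τ * j ≡ k + suc s * a mod n → q ∣ n → q ∣ s →
                      τ * j ≡ k mod q
  translation-≡-mod {a} {τ} {j} {k} {s} {q} eq q∣n q∣s = +-cancelˡ-≡-mod a (begin
    a + τ * j         ≈⟨ ≡-mod-∣ q∣n eq ⟩
    k + suc s * a     ≡⟨ regroup k s a ⟩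
    (a + k) + s * a   ≈⟨ +-congˡ-≡-mod (a + k) (∣⇒≡0-mod (∣m⇒∣m*n a q∣s)) ⟩
    (a + k) + 0       ≡⟨ +-identityʳ (a + k) ⟩
    a + k             ∎)
    where
    open ≡-mod-Reasoning q
    regroup : ∀ k s a → k + suc s * a ≡ (a + k) + s * a
    regroup = solve-∀

  -- A unit σ ≡ 1 (mod q) acts trivially modulo q, so modulo q conjugation only rescales j by a unit.
  conj⇒∣⇔∣ : .{{_ : NonTrivial n}} → (g h : K n) → Conj n g h → ∀ {q} → q ∣ n → q ∣ unit g ∸ 1 →
             q ∣ translation g ⇔ q ∣ translation h
  conj⇒∣⇔∣ ((_ , zero) , _ , _ , 0⊥n) _ _ _ _ = ⊥-elim (Coprime.¬0-coprimeTo-2+ 0⊥n)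
  conj⇒∣⇔∣ g@((j , suc s) , _) h@((k , _) , _) c@(((a , τ) , _ , _ , τ⊥n) , eq) {q} q∣n q∣s =
    ∣⇔∣-≡-mod {q} {τ} q⊥τ (translation-≡-mod {a} {τ} {j} {k} {s} shifts q∣n q∣s)
    where
    shifts : a + τ * j ≡ k + suc s * a mod n
    shifts = %≡⇒≡-mod
      (trans (,-injectiveˡ eq) (cong (λ σ → (k + σ * a) % n) (sym (conj⇒unit≡ g h c))))
    q⊥τ : Coprime q τ
    q⊥τ (d∣q , d∣τ) = τ⊥n (d∣τ , ∣-trans d∣q q∣n)

  conj-any : ∀ (g h : K n) {hs} → Conj n g h → Any (λ h′ → proj₁ h ≡ proj₁ h′) hs →
             Any (Conj n g) hs
  conj-any _ _ (x , eq) = Any.map λ { refl → x , eq }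

module _ {a} {A : Set a} where

  tabulate₂ : ∀ {l} {k : Fin l → ℕ} → ((i : Fin l) → Fin (k i) → A) → List A
  tabulate₂ f = concat (tabulate λ i → tabulate (f i))

  length-tabulate₂ : ∀ {l} {k : Fin l → ℕ} (f : (i : Fin l) → Fin (k i) → A) →
                     length (tabulate₂ f) ≡ sum (tabulate k)
  length-tabulate₂ {zero} f = refl
  length-tabulate₂ {suc l} f = trans (length-++ (tabulate (f Fin.zero)))
    (cong₂ _+_ (length-tabulate (f Fin.zero)) (length-tabulate₂ λ i → f (Fin.suc i)))

  module _ {ℓ} {P : Pred A ℓ} {l} {k : Fin l → ℕ} {f : (i : Fin l) → Fin (k i) → A} where

    any-tabulate₂ : ∀ i j → P (f i j) → Any P (tabulate₂ f)
    any-tabulate₂ i j Pfij = AnyP.concat⁺ (AnyP.tabulate⁺ i (AnyP.tabulate⁺ j Pfij))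

    all-tabulate₂ : (∀ i j → P (f i j)) → All P (tabulate₂ f)
    all-tabulate₂ Pf = AllP.concat⁺ (AllP.tabulate⁺ λ i → AllP.tabulate⁺ (Pf i))

  allPairs-tabulate₂ : ∀ {ℓ} {R : Rel A ℓ} {l} {k : Fin l → ℕ} {f : (i : Fin l) → Fin (k i) → A} →
                       (∀ {i i′} j j′ → i ≢ i′ → R (f i j) (f i′ j′)) →
                       (∀ i {j j′} → j ≢ j′ → R (f i j) (f i j′)) →
                       AllPairs R (tabulate₂ f)
  allPairs-tabulate₂ outer inner = AllPairsP.concat⁺
    (AllP.tabulate⁺ λ i → AllPairsP.tabulate⁺ (inner i))
    (AllPairsP.tabulate⁺ λ i≢i′ → AllP.tabulate⁺ λ j → AllP.tabulate⁺ λ j′ → outer j j′ i≢i′)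

sum-tabulate-const : ∀ l c → sum (tabulate {n = l} λ _ → c) ≡ l * c
sum-tabulate-const zero c = refl
sum-tabulate-const (suc l) c = cong (c +_) (sum-tabulate-const l c)

geometric-sum : ∀ b₁ r → sum (tabulate {n = r} λ e → suc b₁ ^ (r ∸ suc (toℕ e))) * b₁ + 1 ≡ suc b₁ ^ r
geometric-sum b₁ zero = refl
geometric-sum b₁ (suc r) = begin
  (b ^ r + S) * b₁ + 1   ≡⟨ regroup (b ^ r) S b₁ ⟩
  b ^ r * b₁ + (S * b₁ + 1) ≡⟨ cong (b ^ r * b₁ +_) (geometric-sum b₁ r) ⟩
  b ^ r * b₁ + b ^ r     ≡⟨ +-comm (b ^ r * b₁) (b ^ r) ⟩
  b ^ r + b ^ r * b₁     ≡⟨ *-suc (b ^ r) b₁ ⟨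
  b ^ r * b              ≡⟨ *-comm (b ^ r) b ⟩
  b * b ^ r              ∎
  where
  open ≡-Reasoning
  b = suc b₁
  S = sum (tabulate {n = r} λ e → b ^ (r ∸ suc (toℕ e)))
  regroup : ∀ x S b₁ → (x + S) * b₁ + 1 ≡ x * b₁ + (S * b₁ + 1)
  regroup = solve-∀

^-monoʳ-∣ : ∀ b {e e′} → e ≤ e′ → b ^ e ∣ b ^ e′
^-monoʳ-∣ b {e} {e′} e≤e′ = divides (b ^ (e′ ∸ e))
  (trans (cong (b ^_) (sym (m∸n+n≡m e≤e′))) (^-distribˡ-+-* b (e′ ∸ e) e))

module _ {p : ℕ} (p-prime : Prime p) where

  ∤⇒coprime : ∀ {s} → ¬ p ∣ s → Coprime s p
  ∤⇒coprime p∤s (d∣s , d∣p) with prime⇒irreducible p-prime d∣p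
  ... | inj₁ d≡1 = d≡1
  ... | inj₂ refl = contradiction d∣s p∤s

  ∤⇒coprime-^ : ∀ {s} → ¬ p ∣ s → ∀ k → Coprime s (p ^ k)
  ∤⇒coprime-^ p∤s zero (_ , d∣1) = ∣1⇒≡1 d∣1
  ∤⇒coprime-^ p∤s (suc k) (d∣s , d∣p*pᵏ) = ∤⇒coprime-^ p∤s k (d∣s , coprime-divisor d⊥p d∣p*pᵏ)
    where
    d⊥p : Coprime _ p
    d⊥p (c∣d , c∣p) = ∤⇒coprime p∤s (∣-trans c∣d d∣s , c∣p)

  coprime-^⇒∤ : ∀ {s k} → Coprime s (p ^ suc k) → ¬ p ∣ s
  coprime-^⇒∤ s⊥pᵏ⁺¹ p∣s =
    contradiction (s⊥pᵏ⁺¹ (p∣s , m∣m*n _)) (nonTrivial⇒≢1 {{prime⇒nonTrivial p-prime}})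

module PrimePower (p₁ r′ : ℕ) (p-prime : Prime (suc p₁)) where

  p r m n : ℕ
  p = suc p₁
  r = suc r′
  m = p ^ r′
  n = p ^ r

  1<p : 1 < p
  1<p = nonTrivial⇒n>1 p {{prime⇒nonTrivial p-prime}}

  instance
    p₁≢0 : NonZero p₁
    p₁≢0 = >-nonZero (s<s⁻¹ 1<p)
    m≢0 : NonZero m
    m≢0 = m^n≢0 p r′
    n≢0 : NonZero n
    n≢0 = m^n≢0 p r
    n-nonTrivial : NonTrivial n
    n-nonTrivial = n>1⇒nonTrivial (<-≤-trans 1<p (m≤m*n p m))

  p^[1+e]∤p^e : ∀ e → ¬ p ^ suc e ∣ p ^ e
  p^[1+e]∤p^e e = >⇒∤ {{m^n≢0 p e}} (^-monoʳ-< p 1<p (n<1+n e))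

  p^r-split : ∀ {e} → e < r → p ^ (r ∸ suc e) * p ^ suc e ≡ n
  p^r-split {e} e<r = trans (sym (^-distribˡ-+-* p (r ∸ suc e) (suc e))) (cong (p ^_) (m∸n+n≡m e<r))

  unitᴬ : ℕ → ℕ → ℕ
  unitᴬ s q = suc s + q * p

  unitᴬ%p : ∀ {s} q → s < p₁ → unitᴬ s q % p ≡ suc s
  unitᴬ%p {s} q s<p₁ = trans ([m+kn]%n≡m%n (suc s) q p) (m<n⇒m%n≡m (s<s s<p₁))

  unitᴬ<n : ∀ {s q} → s < p₁ → q < m → unitᴬ s q < n
  unitᴬ<n {s} {q} s<p₁ q<m = begin-strict
    suc s + q * p <⟨ +-monoˡ-< (q * p) (s<s s<p₁) ⟩
    suc q * p     ≤⟨ *-monoˡ-≤ p q<m ⟩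
    m * p         ≡⟨ *-comm m p ⟩
    n             ∎
    where open ≤-Reasoning

  unitᴬ⊥n : ∀ {s} q → s < p₁ → Coprime (unitᴬ s q) n
  unitᴬ⊥n q s<p₁ = ∤⇒coprime-^ p-prime
    (λ p∣σ → 0≢1+n (trans (sym (n∣m⇒m%n≡0 _ p p∣σ)) (unitᴬ%p q s<p₁))) r

  unitᴮ : ℕ → ℕ → ℕ
  unitᴮ e t = suc (t * p ^ suc e)

  unitᴮ<n : ∀ {e t} → e < r → t < p ^ (r ∸ suc e) → unitᴮ e t < n
  unitᴮ<n {e} {t} e<r t<R = begin-strict
    suc (t * p ^ suc e)     <⟨ +-monoˡ-< (t * p ^ suc e) (^-monoʳ-< p 1<p {0} {suc e} z<s) ⟩
    suc t * p ^ suc e       ≤⟨ *-monoˡ-≤ (p ^ suc e) t<R ⟩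
    p ^ (r ∸ suc e) * p ^ suc e ≡⟨ p^r-split e<r ⟩
    n                       ∎
    where open ≤-Reasoning

  unitᴮ⊥n : ∀ e t → Coprime (unitᴮ e t) n
  unitᴮ⊥n e t = ∤⇒coprime-^ p-prime (λ p∣σ → p∤1
    (∣m+n∣m⇒∣n (subst (p ∣_) (+-comm 1 (t * p ^ suc e)) p∣σ)
               (∣n⇒∣m*n t {p ^ suc e} (m∣m*n (p ^ e))))) r
    where
    p∤1 : ¬ p ∣ 1
    p∤1 p∣1 = <-irrefl (sym (∣1⇒≡1 p∣1)) 1<p

  repᴬ : Fin p₁ → Fin m → K n
  repᴬ s q = (0 , unitᴬ (toℕ s) (toℕ q)) ,
    m^n>0 p r , unitᴬ<n (toℕ<n s) (toℕ<n q) , unitᴬ⊥n (toℕ q) (toℕ<n s)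

  repᴮ : (e : Fin r) → Fin (p ^ (r ∸ suc (toℕ e))) → K n
  repᴮ e t = (p ^ toℕ e , unitᴮ (toℕ e) (toℕ t)) ,
    ^-monoʳ-< p 1<p (toℕ<n e) , unitᴮ<n (toℕ<n e) (toℕ<n t) , unitᴮ⊥n (toℕ e) (toℕ t)

  reps : List (K n)
  reps = tabulate₂ repᴬ ++ tabulate₂ repᴮ

  length-reps : length reps ≡ classFormula p r
  length-reps = begin
    length (tabulate₂ repᴬ ++ tabulate₂ repᴮ)
      ≡⟨ length-++ (tabulate₂ repᴬ) ⟩
    length (tabulate₂ repᴬ) + length (tabulate₂ repᴮ)
      ≡⟨ cong₂ _+_ (length-tabulate₂ repᴬ) (length-tabulate₂ repᴮ) ⟩
    sum (tabulate {n = p₁} λ _ → m) + S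
      ≡⟨ cong₂ _+_ (sum-tabulate-const p₁ m) S≡ ⟩
    p₁ * m + (n ∸ 1) / p₁
      ∎
    where
    open ≡-Reasoning
    S = sum (tabulate {n = r} λ e → p ^ (r ∸ suc (toℕ e)))
    S≡ : S ≡ (n ∸ 1) / p₁
    S≡ = sym (begin
      (n ∸ 1) / p₁          ≡⟨ cong (λ x → (x ∸ 1) / p₁) (sym (geometric-sum p₁ r)) ⟩
      (S * p₁ + 1 ∸ 1) / p₁ ≡⟨ cong (_/ p₁) (m+n∸n≡m (S * p₁) 1) ⟩
      S * p₁ / p₁           ≡⟨ m*n/n≡m S p₁ ⟩
      S                     ∎)

  unitᴬ-injectiveˡ : ∀ {s s′} q q′ → s < p₁ → s′ < p₁ → unitᴬ s q ≡ unitᴬ s′ q′ → s ≡ s′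
  unitᴬ-injectiveˡ q q′ s<p₁ s′<p₁ eq =
    suc-injective (trans (sym (unitᴬ%p q s<p₁)) (trans (cong (_% p) eq) (unitᴬ%p q′ s′<p₁)))

  unitᴬ-injectiveʳ : ∀ s {q q′} → unitᴬ s q ≡ unitᴬ s q′ → q ≡ q′
  unitᴬ-injectiveʳ s {q} {q′} eq = *-cancelʳ-≡ q q′ p (+-cancelˡ-≡ (suc s) _ _ eq)

  unitᴮ-injective : ∀ e {t t′} → unitᴮ e t ≡ unitᴮ e t′ → t ≡ t′
  unitᴮ-injective e {t} {t′} eq = *-cancelʳ-≡ t t′ (p ^ suc e) {{m^n≢0 p (suc e)}} (suc-injective eq)

  conj-levelˡ : (g h : K n) → Conj n g h → ∀ {e} → e < r → p ^ suc e ∣ unit g ∸ 1 →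
                translation g ≡ p ^ e → ¬ p ^ suc e ∣ translation h
  conj-levelˡ g h c {e} e<r pᵉ⁺¹∣σ-1 refl pᵉ⁺¹∣k =
    p^[1+e]∤p^e e (Equivalence.from (conj⇒∣⇔∣ g h c (^-monoʳ-∣ p e<r) pᵉ⁺¹∣σ-1) pᵉ⁺¹∣k)

  conj-levelʳ : (g h : K n) → Conj n g h → ∀ {e} → e < r → p ^ suc e ∣ unit h ∸ 1 →
                translation h ≡ p ^ e → ¬ p ^ suc e ∣ translation g
  conj-levelʳ g h c {e} e<r pᵉ⁺¹∣σ-1 refl pᵉ⁺¹∣j =
    p^[1+e]∤p^e e (Equivalence.to (conj⇒∣⇔∣ g h c (^-monoʳ-∣ p e<r) pᵉ⁺¹∣σ′-1) pᵉ⁺¹∣j)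
    where
    pᵉ⁺¹∣σ′-1 : p ^ suc e ∣ unit g ∸ 1
    pᵉ⁺¹∣σ′-1 = subst (λ σ → p ^ suc e ∣ σ ∸ 1) (sym (conj⇒unit≡ g h c)) pᵉ⁺¹∣σ-1

  reps-nonconjugate : AllPairs (λ g h → ¬ Conj n g h) reps
  reps-nonconjugate = AllPairsP.++⁺ pairwiseᴬ pairwiseᴮ crossing
    where
    pairwiseᴬ : AllPairs (λ g h → ¬ Conj n g h) (tabulate₂ repᴬ)
    pairwiseᴬ = allPairs-tabulate₂ {f = repᴬ}
      (λ {s} {s′} q q′ s≢s′ c → s≢s′ (toℕ-injective
        (unitᴬ-injectiveˡ (toℕ q) (toℕ q′) (toℕ<n s) (toℕ<n s′) (conj⇒unit≡ (repᴬ s q) (repᴬ s′ q′) c))))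
      (λ s {q} {q′} q≢q′ c → q≢q′ (toℕ-injective (unitᴬ-injectiveʳ (toℕ s)
        (conj⇒unit≡ (repᴬ s q) (repᴬ s q′) c))))

    distinct-levels : ∀ {e e′} t t′ → e ≢ e′ → ¬ Conj n (repᴮ e t) (repᴮ e′ t′)
    distinct-levels {e} {e′} t t′ e≢e′ c with <-cmp (toℕ e) (toℕ e′)
    ... | tri< e<e′ _ _ =
      conj-levelˡ (repᴮ e t) (repᴮ e′ t′) c (toℕ<n e) (n∣m*n (toℕ t)) refl (^-monoʳ-∣ p e<e′)
    ... | tri≈ _ e≡e′ _ = e≢e′ (toℕ-injective e≡e′)
    ... | tri> _ _ e′<e =
      conj-levelʳ (repᴮ e t) (repᴮ e′ t′) c (toℕ<n e′) (n∣m*n (toℕ t′)) refl (^-monoʳ-∣ p e′<e)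

    pairwiseᴮ : AllPairs (λ g h → ¬ Conj n g h) (tabulate₂ repᴮ)
    pairwiseᴮ = allPairs-tabulate₂ {f = repᴮ} distinct-levels
      (λ e {t} {t′} t≢t′ c → t≢t′ (toℕ-injective (unitᴮ-injective (toℕ e)
        (conj⇒unit≡ (repᴮ e t) (repᴮ e t′) c))))

    crossing : All (λ g → All (λ h → ¬ Conj n g h) (tabulate₂ repᴮ)) (tabulate₂ repᴬ)
    crossing = all-tabulate₂ {f = repᴬ} λ s q → all-tabulate₂ {f = repᴮ} λ e t c →
      conj-levelʳ (repᴬ s q) (repᴮ e t) c (toℕ<n e) (n∣m*n (toℕ t)) refl (_∣0 (p ^ suc (toℕ e)))

  ∈-repsᴬ : ∀ {σ} → σ < n → Coprime σ n → Any (λ h → (0 , σ) ≡ proj₁ h) reps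
  ∈-repsᴬ {σ} σ<n σ⊥n with σ % p in σ%p≡
  ... | zero = contradiction (m%n≡0⇒n∣m σ p σ%p≡) (coprime-^⇒∤ p-prime {k = r′} σ⊥n)
  ... | suc s = AnyP.++⁺ˡ (any-tabulate₂ {f = repᴬ} (fromℕ< s<p₁) (fromℕ< q<m) (cong (0 ,_) σ≡))
    where
    s<p₁ : s < p₁
    s<p₁ = s<s⁻¹ (subst (_< p) σ%p≡ (m%n<n σ p))
    q<m : σ / p < m
    q<m = m<n*o⇒m/o<n (subst (σ <_) (*-comm p m) σ<n)
    σ≡ : σ ≡ unitᴬ (toℕ (fromℕ< s<p₁)) (toℕ (fromℕ< q<m))
    σ≡ = trans (m≡m%n+[m/n]*n σ p) (trans (cong (_+ σ / p * p) σ%p≡)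
           (cong₂ unitᴬ (sym (toℕ-fromℕ< s<p₁)) (sym (toℕ-fromℕ< q<m))))

  ∈-repsᴮ : ∀ {e t} → e < r → unitᴮ e t < n → Any (λ h → (p ^ e , unitᴮ e t) ≡ proj₁ h) reps
  ∈-repsᴮ {e} {t} e<r σ<n with fromℕ< e<r | toℕ-fromℕ< e<r
  ... | e′ | refl = AnyP.++⁺ʳ (tabulate₂ repᴬ)
    (any-tabulate₂ {f = repᴮ} e′ (fromℕ< t<R)
      (cong (λ t → p ^ toℕ e′ , unitᴮ (toℕ e′) t) (sym (toℕ-fromℕ< t<R))))
    where
    t<R : t < p ^ (r ∸ suc (toℕ e′))
    t<R = *-cancelʳ-< _ _ _ (<-trans (n<1+n _) (subst (unitᴮ (toℕ e′) t <_) (sym (p^r-split e<r)) σ<n))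

  cofactor-coprime : ∀ {e x w} → x ≡ w * p ^ e → ¬ p ^ suc e ∣ x → Coprime w n
  cofactor-coprime {e} refl pᵉ⁺¹∤x = ∤⇒coprime-^ p-prime (λ p∣w → pᵉ⁺¹∤x (*-monoˡ-∣ (p ^ e) p∣w)) r

  -- Raise e while p^(e+1) divides both j and σ - 1; i = r - e bounds the search.
  conj-to-reps : ∀ {j s} (g : IsK n (j , suc s)) i e → e + i ≡ r → p ^ e ∣ j → p ^ e ∣ s →
                 Any (Conj n ((j , suc s) , g)) reps
  conj-to-reps {j} {s} g@(j<n , σ<n , σ⊥n) zero e e+0≡r pᵉ∣j _ =
    conj-any (_ , g) ((0 , suc s) , h)
      (conj-to-divisor {J = 1} g h (Coprime.1-coprimeTo n) j≡0) (∈-repsᴬ σ<n σ⊥n)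
    where
    h : IsK n (0 , suc s)
    h = m^n>0 p r , σ<n , σ⊥n
    n∣j : n ∣ j
    n∣j = subst (λ k → p ^ k ∣ j) (trans (sym (+-identityʳ e)) e+0≡r) pᵉ∣j
    j≡0 : j ≡ 1 * 0
    j≡0 = trans (sym (m<n⇒m%n≡m j<n)) (n∣m⇒m%n≡0 j n n∣j)
  conj-to-reps {j} {s} g@(_ , σ<n , σ⊥n) (suc i) e e+1+i≡r pᵉ∣j@(divides J j≡) pᵉ∣s@(divides w s≡)
    with p ^ suc e ∣? s | p ^ suc e ∣? j
  ... | no pᵉ⁺¹∤s | _ =
    conj-any (_ , g) ((0 , suc s) , h)
      (conj-to-0 {w = w} {p ^ e} g h (cofactor-coprime {e} s≡ pᵉ⁺¹∤s) s≡ pᵉ∣j) (∈-repsᴬ σ<n σ⊥n)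
    where
    h : IsK n (0 , suc s)
    h = m^n>0 p r , σ<n , σ⊥n
  ... | yes (divides t refl) | no pᵉ⁺¹∤j =
    conj-any (_ , g) ((p ^ e , suc s) , h)
      (conj-to-divisor {J = J} g h (cofactor-coprime {e} j≡ pᵉ⁺¹∤j) j≡) (∈-repsᴮ {e} {t} e<r σ<n)
    where
    e<r : e < r
    e<r = subst (e <_) e+1+i≡r (m<m+n e z<s)
    h : IsK n (p ^ e , suc s)
    h = ^-monoʳ-< p 1<p e<r , σ<n , σ⊥n
  ... | yes pᵉ⁺¹∣s | yes pᵉ⁺¹∣j =
    conj-to-reps g i (suc e) (trans (sym (+-suc e i)) e+1+i≡r) pᵉ⁺¹∣j pᵉ⁺¹∣s

  reps-complete : (g : K n) → Any (Conj n g) reps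
  reps-complete ((_ , zero) , _ , _ , 0⊥n) = ⊥-elim (Coprime.¬0-coprimeTo-2+ 0⊥n)
  reps-complete ((j , suc s) , g) = conj-to-reps g r 0 refl (1∣ j) (1∣ s)

proposition3p6 : (p r : ℕ) → Prime p → ¬ (2 ∣ p) → 1 ≤ r →
    .{{_ : NonZero (p ^ r)}} → .{{_ : NonZero (p ∸ 1)}} →
    NumConjClasses (p ^ r) (classFormula p r)
proposition3p6 zero _ 0-prime = contradiction 0-prime ¬prime[0]
proposition3p6 (suc p₁) zero _ _ ()
proposition3p6 (suc p₁) (suc r′) p-prime _ _ = reps , length-reps , reps-nonconjugate , reps-complete
  where open PrimePower p₁ r′ p-prime
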